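{- Let $G$ be a graph, $d$ a positive integer, and $A\subseteq V(G)$ with $\operatorname{cutrk}^{\mathbb{Q}}(A)=k$. Then for every subset $S\subseteq A$ there exists a subset $R\subseteq S$ with $|R|\le dk$ and $R\equiv^d_A S$.
   Context: Let $\overline{A}=V(G)\setminus A$, and let $N(v)$ denote the neighbourhood of a vertex $v$. $\operatorname{cutrk}^{\mathbb{Q}}(A)$ is the rank over $\mathbb{Q}$ of the $A\times\overline{A}$ matrix $(a_{ij})$, where $a_{ij}=1$ if $i$ and $j$ are adjacent and $a_{ij}=0$ otherwise. For $X,Y\subseteq A$, $X\equiv^d_A Y$ ($d$-neighbour equivalence over the cut $(A,\overline{A})$) means that for every $v\in\overline{A}$, \[ \min\{d,|N(v)\cap X|\}=\min\{d,|N(v)\cap Y|\}. \] -}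

module Defs where

open import Data.Bool using (Bool; true; false; if_then_else_)
open import Data.Nat using (ℕ; zero; suc; _⊓_)
open import Data.Fin using (Fin; zero; suc)
open import Data.Fin.Subset using (Subset; _∈_; _∉_; _∩_; ∣_∣)
open import Data.Vec using (tabulate)
open import Data.Rational using (ℚ; 0ℚ; 1ℚ; _+_; _*_)
open import Data.Product using (Σ; ∃; _×_)
open import Relation.Binary.PropositionalEquality using (_≡_)
open import Relation.Nullary using (¬_)

record Graph (n : ℕ) : Set where
  field
    adj    : Fin n → Fin n → Bool
    sym    : ∀ u v → adj u v ≡ adj v u
    irrefl : ∀ v → adj v v ≡ false
open Graph public

N : ∀ {n} → Graph n → Fin n → Subset n
N G v = tabulate (adj G v)

sumℚ : ∀ {m} → (Fin m → ℚ) → ℚ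
sumℚ {zero}  f = 0ℚ
sumℚ {suc m} f = f zero + sumℚ (λ i → f (suc i))

entry : ∀ {n} → Graph n → Fin n → Fin n → ℚ
entry G i j = if adj G i j then 1ℚ else 0ℚ

RowsIndep : ∀ {n m} → Graph n → Subset n → (Fin m → Fin n) → Set
RowsIndep {n} {m} G A r =
  (c : Fin m → ℚ) →
  (∀ (j : Fin n) → j ∉ A → sumℚ (λ i → c i * entry G (r i) j) ≡ 0ℚ) →
  ∀ i → c i ≡ 0ℚ

-- cutrk^ℚ(A) = k : the rank over ℚ of the A × Ā matrix is k,
-- i.e. the maximal number of linearly independent rows is k.
CutRankℚ : ∀ {n} → Graph n → Subset n → ℕ → Set
CutRankℚ {n} G A k =
  (Σ (Fin k → Fin n) λ r → (∀ i → r i ∈ A) × RowsIndep G A r)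
  × (∀ (r : Fin (suc k) → Fin n) → (∀ i → r i ∈ A) → ¬ RowsIndep G A r)

NeighEquiv : ∀ {n} → Graph n → ℕ → Subset n → Subset n → Subset n → Set
NeighEquiv {n} G d A X Y =
  ∀ (v : Fin n) → v ∉ A → d ⊓ ∣ N G v ∩ X ∣ ≡ d ⊓ ∣ N G v ∩ Y ∣

-- R is built in d rounds.  In each round, greedily pick vertices u of S not yet
-- in R, each together with a pivot v ∉ A adjacent to u but to no previously
-- picked vertex.  The picked rows of the A × Ā matrix are then triangular with
-- respect to their pivots, hence linearly independent, so at most k are picked;
-- and every v ∉ A that still has a neighbour in S outside R gains a new
-- neighbour in R.  After d rounds every v ∉ A either has all of N(v) ∩ S inside
-- R or has at least d neighbours in R, and either way the counts truncated at d
-- agree.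
module Submission where

open import Defs renaming (sym to adj-sym)
open import Data.Bool using (true; false)
open import Data.Bool.Properties using () renaming (_≟_ to _≟ᵇ_)
open import Data.Nat using (ℕ; zero; suc; _+_; _*_; _≤_; _<_; _⊓_; z≤n; s≤s)
open import Data.Nat.Properties
  using (≤-trans; ≤-reflexive; +-suc; +-comm; +-monoˡ-≤; +-monoʳ-≤; n≤1+n;
         m≤n⇒m<n∨m≡n; m≤n⇒m⊓n≡m)
open import Data.Fin using (Fin; zero; suc)
open import Data.Fin.Properties using (any?)
open import Data.Fin.Subset
  using (Subset; _∈_; _∉_; _⊆_; _∩_; _∪_; ⁅_⁆; ∣_∣; ⊥; inside; outside)
open import Data.Fin.Subset.Properties
  using (_∈?_; ∉⊥; p⊆p∪q; ∣⊥∣≡0; ∣⁅x⁆∣≡1; x∈⁅x⁆; x∈⁅y⁆⇒x≡y; x∈p∪q⁺; x∈p∪q⁻;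
         x∈p∩q⁺; x∈p∩q⁻; ⊆-antisym; p⊆q⇒∣p∣≤∣q∣; p⊂q⇒∣p∣<∣q∣)
open import Data.Vec using ([]; _∷_; tabulate)
open import Data.Vec.Properties using (lookup∘tabulate; lookup⇒[]=; []=⇒lookup)
open import Data.List using (List; []; _∷_; length; lookup; allFin)
open import Data.List.Relation.Unary.All as All using (All; []; _∷_)
open import Data.List.Relation.Unary.All.Properties using (¬Any⇒All¬)
open import Data.List.Relation.Unary.Any as Any using (Any; here; there)
open import Data.List.Membership.Propositional.Properties using (∈-allFin; ∈-lookup)
open import Data.Product using (Σ; ∃; _×_; _,_; proj₁; proj₂)
open import Data.Sum using (_⊎_; inj₁; inj₂)
open import Data.Empty using (⊥-elim)
open import Data.Rational using (ℚ; 0ℚ; 1ℚ) renaming (_+_ to _+ℚ_; _*_ to _*ℚ_)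
open import Data.Rational.Properties using (+-identityˡ; +-identityʳ; *-identityʳ; *-zeroˡ; *-zeroʳ)
open import Function using (_∘_)
open import Level using (0ℓ)
open import Relation.Binary.PropositionalEquality
  using (_≡_; _≢_; refl; sym; trans; cong; cong₂; subst; module ≡-Reasoning)
open import Relation.Nullary using (¬_; Dec; yes; no)
open import Relation.Nullary.Decidable using (_×-dec_; ¬?)
open import Relation.Unary using (Pred; Decidable)

∣p∪q∣≤∣p∣+∣q∣ : ∀ {n} (p q : Subset n) → ∣ p ∪ q ∣ ≤ ∣ p ∣ + ∣ q ∣
∣p∪q∣≤∣p∣+∣q∣ []            []            = z≤n
∣p∪q∣≤∣p∣+∣q∣ (outside ∷ p) (outside ∷ q) = ∣p∪q∣≤∣p∣+∣q∣ p q
∣p∪q∣≤∣p∣+∣q∣ (outside ∷ p) (inside  ∷ q) = ≤-trans (s≤s (∣p∪q∣≤∣p∣+∣q∣ p q)) (≤-reflexive (sym (+-suc _ _)))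
∣p∪q∣≤∣p∣+∣q∣ (inside  ∷ p) (outside ∷ q) = s≤s (∣p∪q∣≤∣p∣+∣q∣ p q)
∣p∪q∣≤∣p∣+∣q∣ (inside  ∷ p) (inside  ∷ q) = s≤s (≤-trans (∣p∪q∣≤∣p∣+∣q∣ p q) (+-monoʳ-≤ ∣ p ∣ (n≤1+n _)))

∩-monoʳ-⊆ : ∀ {n} (p : Subset n) {q r : Subset n} → q ⊆ r → p ∩ q ⊆ p ∩ r
∩-monoʳ-⊆ p {q} q⊆r x∈p∩q = let (x∈p , x∈q) = x∈p∩q⁻ p q x∈p∩q in x∈p∩q⁺ (x∈p , q⊆r x∈q)

⊓-count-agrees : ∀ {n} d (p R S : Subset n) → R ⊆ S →
                 (p ∩ S ⊆ R ⊎ d ≤ ∣ p ∩ R ∣) → d ⊓ ∣ p ∩ R ∣ ≡ d ⊓ ∣ p ∩ S ∣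
⊓-count-agrees d p R S R⊆S (inj₁ p∩S⊆R) =
  cong (λ X → d ⊓ ∣ X ∣) (⊆-antisym (∩-monoʳ-⊆ p R⊆S) p∩S⊆p∩R)
  where
    p∩S⊆p∩R : p ∩ S ⊆ p ∩ R
    p∩S⊆p∩R x∈p∩S = x∈p∩q⁺ (proj₁ (x∈p∩q⁻ p S x∈p∩S) , p∩S⊆R x∈p∩S)
⊓-count-agrees d p R S R⊆S (inj₂ d≤∣p∩R∣) = begin
  d ⊓ ∣ p ∩ R ∣  ≡⟨ m≤n⇒m⊓n≡m d≤∣p∩R∣ ⟩
  d              ≡⟨ m≤n⇒m⊓n≡m (≤-trans d≤∣p∩R∣ (p⊆q⇒∣p∣≤∣q∣ (∩-monoʳ-⊆ p R⊆S))) ⟨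
  d ⊓ ∣ p ∩ S ∣  ∎
  where open ≡-Reasoning

sumℚ-zero : ∀ {m} (f : Fin m → ℚ) → (∀ i → f i ≡ 0ℚ) → sumℚ f ≡ 0ℚ
sumℚ-zero {zero}  f f≡0 = refl
sumℚ-zero {suc m} f f≡0 = trans (cong₂ _+ℚ_ (f≡0 zero) (sumℚ-zero (f ∘ suc) (f≡0 ∘ suc))) (+-identityʳ 0ℚ)

module _ {n} (G : Graph n) where

  adj⇒∈N : ∀ {v x} → adj G v x ≡ true → x ∈ N G v
  adj⇒∈N {v} {x} e = lookup⇒[]= x (tabulate (adj G v)) (trans (lookup∘tabulate (adj G v) x) e)

  ∈N⇒adj : ∀ {v x} → x ∈ N G v → adj G v x ≡ true
  ∈N⇒adj {v} {x} x∈N = trans (sym (lookup∘tabulate (adj G v) x)) ([]=⇒lookup x∈N)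

  entry≡1 : ∀ {b v} → adj G b v ≡ true → entry G b v ≡ 1ℚ
  entry≡1 e rewrite e = refl

  entry≡0 : ∀ {b v} → adj G b v ≢ true → entry G b v ≡ 0ℚ
  entry≡0 {b} {v} ¬e with adj G b v
  ... | true  = ⊥-elim (¬e refl)
  ... | false = refl

  -- (row, pivot column) pairs, the most recently picked first.
  Pivots : Set
  Pivots = List (Fin n × Fin n)

  rows : (L : Pivots) → Fin (length L) → Fin n
  rows L = proj₁ ∘ lookup L

  rowSet : Pivots → Subset n
  rowSet []            = ⊥
  rowSet ((b , _) ∷ L) = ⁅ b ⁆ ∪ rowSet L

  ∣rowSet∣≤length : ∀ L → ∣ rowSet L ∣ ≤ length L
  ∣rowSet∣≤length []            = ≤-reflexive (∣⊥∣≡0 n)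
  ∣rowSet∣≤length ((b , _) ∷ L) = ≤-trans (∣p∪q∣≤∣p∣+∣q∣ ⁅ b ⁆ (rowSet L))
    (subst (λ m → m + ∣ rowSet L ∣ ≤ suc (length L)) (sym (∣⁅x⁆∣≡1 b)) (s≤s (∣rowSet∣≤length L)))

  rowSet-All : ∀ (P : Pred (Fin n) 0ℓ) {L} → All (P ∘ proj₁) L → ∀ {x} → x ∈ rowSet L → P x
  rowSet-All P {[]}          []        x∈⊥ = ⊥-elim (∉⊥ x∈⊥)
  rowSet-All P {(b , _) ∷ L} (Pb ∷ PL) {x} x∈ with x∈p∪q⁻ ⁅ b ⁆ (rowSet L) x∈
  ... | inj₁ x∈⁅b⁆ = subst P (sym (x∈⁅y⁆⇒x≡y b x∈⁅b⁆)) Pb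
  ... | inj₂ x∈L   = rowSet-All P PL x∈L

  rowSet-Any : ∀ (P : Pred (Fin n) 0ℓ) {L} → Any (P ∘ proj₁) L → ∃ λ x → x ∈ rowSet L × P x
  rowSet-Any P {(b , _) ∷ L} (here Pb) = b , x∈p∪q⁺ (inj₁ (x∈⁅x⁆ b)) , Pb
  rowSet-Any P {_      ∷ L} (there PL) with rowSet-Any P PL
  ... | x , x∈L , Px = x , x∈p∪q⁺ (inj₂ x∈L) , Px

  Sees : Fin n → Fin n × Fin n → Set
  Sees v (b , _) = adj G b v ≡ true

  -- Each row sees its pivot and no later row does: the rows restricted to the
  -- pivot columns form a unitriangular matrix.
  data Triangular (A : Subset n) : Pivots → Set where
    []  : Triangular A []
    _∷_ : ∀ {b v L} → b ∈ A × v ∉ A × adj G b v ≡ true × All (¬_ ∘ Sees v) L →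
          Triangular A L → Triangular A ((b , v) ∷ L)

  module _ {A : Subset n} where

    triangular⇒rows∈A : ∀ {L} → Triangular A L → ∀ i → rows L i ∈ A
    triangular⇒rows∈A ((b∈A , _) ∷ _) zero    = b∈A
    triangular⇒rows∈A (_         ∷ t) (suc i) = triangular⇒rows∈A t i

    triangular⇒independent : ∀ {L} → Triangular A L → RowsIndep G A (rows L)
    triangular⇒independent [] c _ ()
    triangular⇒independent {(b , v) ∷ L} ((_ , v∉A , b~v , L≁v) ∷ t) c Σc≡0 = c≡0
      where
        tail : Fin n → ℚ
        tail j = sumℚ (λ i → c (suc i) *ℚ entry G (rows L i) j)

        tail-at-pivot : tail v ≡ 0ℚ
        tail-at-pivot = sumℚ-zero _ λ i →
          trans (cong (c (suc i) *ℚ_) (entry≡0 (All.lookup L≁v (∈-lookup i)))) (*-zeroʳ (c (suc i)))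

        open ≡-Reasoning

        head≡0 : c zero ≡ 0ℚ
        head≡0 = begin
          c zero                           ≡⟨ *-identityʳ (c zero) ⟨
          c zero *ℚ 1ℚ                     ≡⟨ cong (c zero *ℚ_) (entry≡1 b~v) ⟨
          c zero *ℚ entry G b v            ≡⟨ +-identityʳ _ ⟨
          c zero *ℚ entry G b v +ℚ 0ℚ      ≡⟨ cong (c zero *ℚ entry G b v +ℚ_) tail-at-pivot ⟨
          c zero *ℚ entry G b v +ℚ tail v  ≡⟨ Σc≡0 v v∉A ⟩
          0ℚ                               ∎

        tail≡0 : ∀ j → j ∉ A → tail j ≡ 0ℚ
        tail≡0 j j∉A = begin
          tail j                           ≡⟨ +-identityˡ (tail j) ⟨
          0ℚ +ℚ tail j                     ≡⟨ cong (_+ℚ tail j) (*-zeroˡ (entry G b j)) ⟨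
          0ℚ *ℚ entry G b j +ℚ tail j      ≡⟨ cong (λ x → x *ℚ entry G b j +ℚ tail j) head≡0 ⟨
          c zero *ℚ entry G b j +ℚ tail j  ≡⟨ Σc≡0 j j∉A ⟩
          0ℚ                               ∎

        c≡0 : ∀ i → c i ≡ 0ℚ
        c≡0 zero    = head≡0
        c≡0 (suc i) = triangular⇒independent t (c ∘ suc) tail≡0 i

    triangular⇒length≤cutrk : ∀ {k L} → CutRankℚ G A k → Triangular A L → length L ≤ k
    triangular⇒length≤cutrk cut []                 = z≤n
    triangular⇒length≤cutrk cut t@(_ ∷ t′) with m≤n⇒m<n∨m≡n (triangular⇒length≤cutrk cut t′)
    ... | inj₁ <k    = <k
    ... | inj₂ refl  = ⊥-elim (proj₂ cut _ (triangular⇒rows∈A t) (triangular⇒independent t))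

    Covers : Pivots → Fin n → Set
    Covers L v = Any (Sees v) L

    covers? : ∀ L v → Dec (Covers L v)
    covers? L v = Any.any? (λ (b , _) → adj G b v ≟ᵇ true) L

    module Greedy (T : Pred (Fin n) 0ℓ) (T? : Decidable T) (T⊆A : ∀ {u} → T u → u ∈ A) where

      Saturated : Pivots → Fin n → Set
      Saturated L u = T u → ∀ {v} → v ∉ A → adj G u v ≡ true → Covers L v

      record Extension (L : Pivots) (us : List (Fin n)) : Set where
        field
          pivots     : Pivots
          triangular : Triangular A pivots
          rows∈T     : All (T ∘ proj₁) pivots
          grows      : ∀ {v} → Covers L v → Covers pivots v
          saturated  : All (Saturated pivots) us
      open Extension

      prepend : ∀ {L L′ u us} → (∀ {v} → Covers L v → Covers L′ v) →
                (E : Extension L′ us) → Saturated (pivots E) u → Extension L (u ∷ us)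
      prepend L⊑L′ E sat = record
        { pivots = pivots E ; triangular = triangular E ; rows∈T = rows∈T E
        ; grows = grows E ∘ L⊑L′ ; saturated = sat ∷ saturated E }

      extend : ∀ {L} → Triangular A L → All (T ∘ proj₁) L → ∀ us → Extension L us
      extend {L} t L⊆T [] = record
        { pivots = L ; triangular = t ; rows∈T = L⊆T ; grows = λ c → c ; saturated = [] }
      extend {L} t L⊆T (u ∷ us) with T? u
      ... | no ¬Tu = prepend (λ c → c) E (⊥-elim ∘ ¬Tu)
        where E = extend t L⊆T us
      ... | yes Tu with any? (λ v → ¬? (v ∈? A) ×-dec (adj G u v ≟ᵇ true) ×-dec ¬? (covers? L v))
      ...   | yes (v , v∉A , u~v , ¬Lv) = prepend there E (λ _ _ u~w → grows E (here u~w))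
        where E = extend ((T⊆A Tu , v∉A , u~v , ¬Any⇒All¬ L ¬Lv) ∷ t) (Tu ∷ L⊆T) us
      ...   | no ¬∃ = prepend (λ c → c) E (λ _ w∉A u~w → grows E (already w∉A u~w))
        where
          E = extend t L⊆T us
          already : ∀ {w} → w ∉ A → adj G u w ≡ true → Covers L w
          already {w} w∉A u~w with covers? L w
          ... | yes Lw = Lw
          ... | no ¬Lw = ⊥-elim (¬∃ (w , w∉A , u~w , ¬Lw))

      greedy : Extension [] (allFin n)
      greedy = extend [] [] (allFin n)

      greedy-saturated : ∀ u → Saturated (pivots greedy) u
      greedy-saturated u = All.lookup (saturated greedy) (∈-allFin u)

module _ {n} (G : Graph n) {A : Subset n} {k} (cut : CutRankℚ G A k) {S : Subset n} (S⊆A : S ⊆ A) where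

  augment : ∀ {R} → R ⊆ S →
            Σ (Subset n) λ R′ → R ⊆ R′ × R′ ⊆ S × ∣ R′ ∣ ≤ ∣ R ∣ + k ×
            (∀ v → v ∉ A → N G v ∩ S ⊆ R ⊎ ∣ N G v ∩ R ∣ < ∣ N G v ∩ R′ ∣)
  augment {R} R⊆S = R ∪ B , p⊆p∪q B , R∪B⊆S , size , progress
    where
      T : Pred (Fin n) 0ℓ
      T u = u ∈ S × u ∉ R

      T? : Decidable T
      T? u = u ∈? S ×-dec ¬? (u ∈? R)

      open Greedy G T T? (S⊆A ∘ proj₁)
      open Extension greedy using (pivots; triangular; rows∈T)

      B = rowSet G pivots

      B⊆T : ∀ {x} → x ∈ B → T x
      B⊆T = rowSet-All G T rows∈T

      R∪B⊆S : R ∪ B ⊆ S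
      R∪B⊆S {x} x∈ with x∈p∪q⁻ R B x∈
      ... | inj₁ x∈R = R⊆S x∈R
      ... | inj₂ x∈B = proj₁ (B⊆T x∈B)

      size : ∣ R ∪ B ∣ ≤ ∣ R ∣ + k
      size = ≤-trans (∣p∪q∣≤∣p∣+∣q∣ R B) (+-monoʳ-≤ ∣ R ∣
        (≤-trans (∣rowSet∣≤length G pivots) (triangular⇒length≤cutrk G cut triangular)))

      progress : ∀ v → v ∉ A → N G v ∩ S ⊆ R ⊎ ∣ N G v ∩ R ∣ < ∣ N G v ∩ (R ∪ B) ∣
      progress v v∉A with any? (λ u → T? u ×-dec (adj G u v ≟ᵇ true))
      ... | no ¬∃ = inj₁ N∩S⊆R
        where
          N∩S⊆R : N G v ∩ S ⊆ R
          N∩S⊆R {x} x∈ with x∈p∩q⁻ (N G v) S x∈ | x ∈? R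
          ... | _          | yes x∈R = x∈R
          ... | x∈N , x∈S  | no x∉R  = ⊥-elim (¬∃ (x , (x∈S , x∉R) , trans (adj-sym G x v) (∈N⇒adj G x∈N)))
      ... | yes (u , Tu , u~v) with rowSet-Any G (λ b → adj G b v ≡ true) (greedy-saturated u Tu v∉A u~v)
      ...   | b , b∈B , b~v = inj₂ (p⊂q⇒∣p∣<∣q∣ (∩-monoʳ-⊆ (N G v) (p⊆p∪q B) , b , b∈N∩R∪B , b∉N∩R))
        where
          b∈N∩R∪B : b ∈ N G v ∩ (R ∪ B)
          b∈N∩R∪B = x∈p∩q⁺ (adj⇒∈N G (trans (adj-sym G v b) b~v) , x∈p∪q⁺ (inj₂ b∈B))
          b∉N∩R : b ∉ N G v ∩ R
          b∉N∩R b∈ = proj₂ (B⊆T b∈B) (proj₂ (x∈p∩q⁻ (N G v) R b∈))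

  Invariant : ℕ → Subset n → Set
  Invariant i R = R ⊆ S × ∣ R ∣ ≤ i * k × (∀ v → v ∉ A → N G v ∩ S ⊆ R ⊎ i ≤ ∣ N G v ∩ R ∣)

  rounds : ∀ i → Σ (Subset n) (Invariant i)
  rounds zero = ⊥ , (λ x∈⊥ → ⊥-elim (∉⊥ x∈⊥)) , ≤-reflexive (∣⊥∣≡0 n) , λ _ _ → inj₂ z≤n
  rounds (suc i) with rounds i
  ... | R , R⊆S , ∣R∣≤ik , old with augment R⊆S
  ... | R′ , R⊆R′ , R′⊆S , ∣R′∣≤ , step = R′ , R′⊆S , size , new
    where
      size : ∣ R′ ∣ ≤ suc i * k
      size = ≤-trans ∣R′∣≤ (≤-trans (+-monoˡ-≤ k ∣R∣≤ik) (≤-reflexive (+-comm (i * k) k)))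

      new : ∀ v → v ∉ A → N G v ∩ S ⊆ R′ ⊎ suc i ≤ ∣ N G v ∩ R′ ∣
      new v v∉A with old v v∉A | step v v∉A
      ... | inj₁ N∩S⊆R | _          = inj₁ (R⊆R′ ∘ N∩S⊆R)
      ... | inj₂ _     | inj₁ N∩S⊆R = inj₁ (R⊆R′ ∘ N∩S⊆R)
      ... | inj₂ i≤    | inj₂ <     = inj₂ (≤-trans (s≤s i≤) <)

mainTheorem5 : ∀ {n : ℕ} (G : Graph n) (d : ℕ) → 1 ≤ d →
    (A : Subset n) (k : ℕ) → CutRankℚ G A k →
    ∀ (S : Subset n) → S ⊆ A →
    Σ (Subset n) λ R → R ⊆ S × ∣ R ∣ ≤ d * k × NeighEquiv G d A R S
mainTheorem5 G d _ A k cut S S⊆A with rounds G cut S⊆A d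
... | R , R⊆S , ∣R∣≤dk , done = R , R⊆S , ∣R∣≤dk , λ v v∉A → ⊓-count-agrees d (N G v) R S R⊆S (done v v∉A)
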